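{- Let $n\ge5$ be odd, $T=\langle n,3n-2,3n-1\rangle$, $\mathrm F(T)=\max(\mathbb Z\setminus T)$ and $S=T\cup\{\mathrm F(T)\}$. An element $s\in\mathrm{Ap}(S,\mathrm F(T))$ has exactly one factorization (i.e. $\#\mathsf Z(s)=1$) if and only if $\mathrm{nf}(s)$ satisfies one of the following (mutually disjoint) conditions: 1) $\mathrm{nf}(s)=(x,0,0)$ with $0\le x\le\frac{3n-3}{2}$; 2) $\mathrm{nf}(s)=(x,0,1)$ with $0\le x\le\frac{3n-7}{2}$; 3) $\mathrm{nf}(s)=(2,y,0)$ with $1\le y\le\frac{n-3}{2}$; 4) $\mathrm{nf}(s)=(x,y,0)$ with $0\le x\le1$ and $1\le y\le\frac{n-1}{2}$; 5) $\mathrm{nf}(s)=(x,y,1)$ with $0\le x\le2$ and $1\le y\le\frac{n-5}{2}$.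
   Context: For $m\in S\setminus\{0\}$, $\mathrm{Ap}(S,m)=\{s\in S: s-m\notin S\}$. For $s\in\mathrm{Ap}(S,\mathrm F(T))$ (such $s$ lie in $T$), $\mathsf Z(s)=\{(x,y,z)\in\mathbb N^3: xn+y(3n-2)+z(3n-1)=s\}$ is its set of factorizations, and its normal form $\mathrm{nf}(s)$ is the unique element $(x,y,z)\in\mathsf Z(s)$ with $z<2$, $y<\frac{n+1}{2}$, $x<\frac{3n-1}{2}$. -}

module Defs where

open import Data.Nat using (ℕ; _+_; _*_; _∸_; _≤_; _<_)
open import Data.Product using (_×_; _,_; ∃; ∃-syntax; ∃!)
open import Data.Sum using (_⊎_)
open import Relation.Nullary using (¬_)
open import Relation.Binary.PropositionalEquality using (_≡_)

Triple : Set
Triple = ℕ × ℕ × ℕ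

IsFact : ℕ → ℕ → Triple → Set
IsFact n s (x , y , z) = x * n + y * (3 * n ∸ 2) + z * (3 * n ∸ 1) ≡ s

InT : ℕ → ℕ → Set
InT n s = ∃[ t ] IsFact n s t

-- f = F(T) = max(ℤ \ T)  (stated on ℕ: f is a gap and all larger integers lie in T)
IsFrobT : ℕ → ℕ → Set
IsFrobT n f = ¬ InT n f × (∀ m → f < m → InT n m)

InS : ℕ → ℕ → ℕ → Set
InS n f s = InT n s ⊎ s ≡ f

-- s ∈ Ap(S, f) : s ∈ S and s - f ∉ S (s - f < 0 is never in S)
InAp : ℕ → ℕ → ℕ → Set
InAp n f s = InS n f s × (f ≤ s → ¬ InS n f (s ∸ f))

UniqueFact : ℕ → ℕ → Set
UniqueFact n s = ∃! _≡_ (IsFact n s)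

IsNF : ℕ → ℕ → Triple → Set
IsNF n s (x , y , z) = IsFact n s (x , y , z) × z < 2 × 2 * y < n + 1 × 2 * x < 3 * n ∸ 1

-- the five conditions of the theorem (halves cleared by multiplying by 2)
Cond : ℕ → Triple → Set
Cond n (x , y , z) =
    (y ≡ 0 × z ≡ 0 × 2 * x ≤ 3 * n ∸ 3)
  ⊎ (y ≡ 0 × z ≡ 1 × 2 * x ≤ 3 * n ∸ 7)
  ⊎ (x ≡ 2 × z ≡ 0 × 1 ≤ y × 2 * y ≤ n ∸ 3)
  ⊎ (z ≡ 0 × x ≤ 1 × 1 ≤ y × 2 * y ≤ n ∸ 1)
  ⊎ (z ≡ 1 × x ≤ 2 × 1 ≤ y × 2 * y ≤ n ∸ 5)

-- Write n = k + 1 and, for t = (x, y, z), eval t = x n + y (3n - 2) + z (3n - 1),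
-- weight t = 2y + z and mass t = x + 3y + 3z. Then eval t + weight t = mass t * n, so the
-- weights of all factorizations of s are congruent to -s mod n, and
-- 2 eval t = weight t (3n - 2) + (2x + 3z) n bounds them.
-- If weight t < n and 2x + 3z < 3n - 2, every factorization of s therefore has the weight
-- and mass of t; triples with equal weight and mass differ by multiples of the trade
-- (3, 1, -2), which z ≤ 1 and (x ≤ 2 or y = 0) exclude. Each of the five conditions gives
-- these hypotheses. Conversely, for n = 5 + 2m the same congruence gives
-- F(T) = (3n - 4)(n - 1)/2, and every normal form outside the five conditions either has
-- a second factorization (by the trade, by ((n+1)/2)(3n-2) = ((3n-5)/2) n + (3n-1) or by
-- ((3n+1)/2) n = ((n-1)/2)(3n-2) + (3n-1)) or lies in F(T) + T, so it is not in Ap(S, F(T)).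

module Submission where

open import Data.Empty using (⊥-elim)
open import Data.List.Base using (_∷_; [])
open import Data.Nat using (ℕ; zero; suc; _+_; _*_; _∸_; _≤_; _<_; z≤n; s≤s; s≤s⁻¹; z<s; _≤?_)
open import Data.Nat.Divisibility using (_∣_; _∣0; ∣-refl; ∣m∣n⇒∣m+n)
open import Data.Nat.Properties
open import Data.Nat.Tactic.RingSolver using (solve-∀; solve)
open import Data.Product using (_×_; _,_; proj₁; proj₂; ∃; ∃-syntax)
open import Data.Sum using (_⊎_; inj₁; inj₂)
open import Function.Base using (_∘_)
open import Function.Bundles using (_⇔_; mk⇔)
open import Relation.Binary.Definitions using (tri<; tri≈; tri>)
open import Relation.Binary.PropositionalEquality
open import Relation.Nullary using (¬_; yes; no)

open import Defs

-- n = suc k, so that 3n - 2 = 1 + 3k and 3n - 1 = 2 + 3k involve no truncated subtraction.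
-- INLINE (here and on weight, mass, frob) lets the ring solver see the polynomial behind the name.
eval : ℕ → Triple → ℕ
eval k t = let (x , y , z) = t in x * suc k + y * (1 + 3 * k) + z * (2 + 3 * k)
{-# INLINE eval #-}

IsFact⇒eval≡ : ∀ k {s} t → IsFact (suc k) s t → eval k t ≡ s
IsFact⇒eval≡ k {s} (x , y , z) = subst (λ p → x * suc k + y * (p ∸ 2) + z * (p ∸ 1) ≡ s) (*-suc 3 k)

eval≡⇒IsFact : ∀ k {s} t → eval k t ≡ s → IsFact (suc k) s t
eval≡⇒IsFact k {s} (x , y , z) = subst (λ p → x * suc k + y * (p ∸ 2) + z * (p ∸ 1) ≡ s) (sym (*-suc 3 k))

eval-y→z : ∀ k x y z → eval k (x , y , suc z) ≡ suc (eval k (x , suc y , z))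
eval-y→z = solve-∀

eval-z→x : ∀ k x y z → eval k (3 + x , y , z) ≡ suc (eval k (x , y , suc z))
eval-z→x = solve-∀

eval-trade : ∀ k x y z → eval k (3 + x , suc y , z) ≡ eval k (x , y , 2 + z)
eval-trade = solve-∀

weight : Triple → ℕ
weight t = let (_ , y , z) = t in 2 * y + z
{-# INLINE weight #-}

mass : Triple → ℕ
mass t = let (x , y , z) = t in x + 3 * y + 3 * z
{-# INLINE mass #-}

eval+weight≡mass*[1+k] : ∀ k t → eval k t + weight t ≡ mass t * suc k
eval+weight≡mass*[1+k] k (x , y , z) = solve (k ∷ x ∷ y ∷ z ∷ [])

2*eval≡weight*[1+3k]+[2x+3z]*[1+k] : ∀ k x y z →
  2 * eval k (x , y , z) ≡ weight (x , y , z) * (1 + 3 * k) + (2 * x + 3 * z) * suc k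
2*eval≡weight*[1+3k]+[2x+3z]*[1+k] = solve-∀

[y+z]*[1+3k]≤eval : ∀ k x y z → (y + z) * (1 + 3 * k) ≤ eval k (x , y , z)
[y+z]*[1+3k]≤eval k x y z = begin
  (y + z) * (1 + 3 * k)                   ≤⟨ m≤m+n _ (x * suc k + z) ⟩
  (y + z) * (1 + 3 * k) + (x * suc k + z) ≡⟨ solve (k ∷ x ∷ y ∷ z ∷ []) ⟩
  eval k (x , y , z)                      ∎
  where open ≤-Reasoning

residue-unique : ∀ {n e e′ q q′} → e < n → e′ < e + n → e + q * n ≡ e′ + q′ * n → e ≡ e′ × q ≡ q′
residue-unique {n} {e} {e′} {q} {q′} e<n e′<e+n eq = +-cancelʳ-≡ (q * n) e e′ eq′ , q≡q′
  where
  open ≤-Reasoning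
  q′≤q : q′ ≤ q
  q′≤q = s≤s⁻¹ (*-cancelʳ-< n q′ (suc q) (begin-strict
    q′ * n      ≤⟨ m≤n+m (q′ * n) e′ ⟩
    e′ + q′ * n ≡⟨ sym eq ⟩
    e + q * n   <⟨ +-monoˡ-< (q * n) e<n ⟩
    n + q * n   ∎))
  q≤q′ : q ≤ q′
  q≤q′ = s≤s⁻¹ (*-cancelʳ-< n q (suc q′) (+-cancelˡ-< e (q * n) (suc q′ * n) (begin-strict
    e + q * n        ≡⟨ eq ⟩
    e′ + q′ * n      <⟨ +-monoˡ-< (q′ * n) e′<e+n ⟩
    e + n + q′ * n   ≡⟨ +-assoc e n (q′ * n) ⟩
    e + (n + q′ * n) ∎)))
  q≡q′ : q ≡ q′
  q≡q′ = ≤-antisym q≤q′ q′≤q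
  eq′ : e + q * n ≡ e′ + q * n
  eq′ = trans eq (cong (λ p → e′ + p * n) (sym q≡q′))

odd⇒≡1+2* : ∀ n → ¬ 2 ∣ n → ∃[ j ] n ≡ 1 + 2 * j
odd⇒≡1+2* zero 2∤n = ⊥-elim (2∤n (2 ∣0))
odd⇒≡1+2* (suc zero) _ = 0 , refl
odd⇒≡1+2* (suc (suc n)) 2∤n with odd⇒≡1+2* n (2∤n ∘ ∣m∣n⇒∣m+n ∣-refl)
... | j , refl = suc j , solve (j ∷ [])

odd≥5⇒≡5+2* : ∀ {n} → 5 ≤ n → ¬ 2 ∣ n → ∃[ m ] n ≡ 5 + 2 * m
odd≥5⇒≡5+2* {n} 5≤n 2∤n with odd⇒≡1+2* n 2∤n
odd≥5⇒≡5+2* (s≤s ()) _ | zero , refl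
odd≥5⇒≡5+2* (s≤s (s≤s (s≤s ()))) _ | suc zero , refl
... | suc (suc m) , refl = m , solve (m ∷ [])

weight-mass-unique : ∀ k t {e q} → weight t < suc k → e < weight t + suc k →
  eval k t + e ≡ q * suc k → weight t ≡ e × q ≡ mass t
weight-mass-unique k t@(x , y , z) {e} {q} w<n e<w+n eval+e≡ = residue-unique w<n e<w+n (begin
  weight t + q * suc k          ≡⟨ cong (weight t +_) (sym eval+e≡) ⟩
  weight t + (eval k t + e)     ≡⟨ solve (k ∷ x ∷ y ∷ z ∷ e ∷ []) ⟩
  e + (eval k t + weight t)     ≡⟨ cong (e +_) (eval+weight≡mass*[1+k] k t) ⟩
  e + mass t * suc k            ∎)
  where open ≡-Reasoning

2y+z≡2y′+z′⇒y′≤y : ∀ {y z y′ z′} → z ≤ 1 → 2 * y + z ≡ 2 * y′ + z′ → y′ ≤ y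
2y+z≡2y′+z′⇒y′≤y {y} {z} {y′} {z′} z≤1 eq = s≤s⁻¹ (*-cancelˡ-< 2 y′ (suc y) (begin-strict
  2 * y′      ≤⟨ m≤m+n (2 * y′) z′ ⟩
  2 * y′ + z′ ≡⟨ sym eq ⟩
  2 * y + z   ≤⟨ +-monoʳ-≤ (2 * y) z≤1 ⟩
  2 * y + 1   <⟨ +-monoʳ-< (2 * y) (n<1+n 1) ⟩
  2 * y + 2   ≡⟨ solve (y ∷ []) ⟩
  2 * suc y   ∎))
  where open ≤-Reasoning

weight-mass-trade : ∀ {x y z x′ y′ z′} → z ≤ 1 →
  weight (x , y , z) ≡ weight (x′ , y′ , z′) → mass (x , y , z) ≡ mass (x′ , y′ , z′) →
  ∃ λ d → x ≡ 3 * d + x′ × y ≡ d + y′ × z′ ≡ 2 * d + z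
weight-mass-trade {x} {y} {z} {x′} {y′} {z′} z≤1 w≡ m≡ with m≤n⇒∃[o]m+o≡n {y′} {y} (2y+z≡2y′+z′⇒y′≤y z≤1 w≡)
... | d , refl = d , x≡ , +-comm y′ d , z′≡
  where
  open ≡-Reasoning
  z′≡ : z′ ≡ 2 * d + z
  z′≡ = +-cancelˡ-≡ (2 * y′) z′ (2 * d + z) (begin
    2 * y′ + z′          ≡⟨ sym w≡ ⟩
    2 * (y′ + d) + z     ≡⟨ solve (y′ ∷ d ∷ z ∷ []) ⟩
    2 * y′ + (2 * d + z) ∎)
  x≡ : x ≡ 3 * d + x′
  x≡ = +-cancelʳ-≡ (3 * (y′ + d) + 3 * z) x (3 * d + x′) (begin
    x + (3 * (y′ + d) + 3 * z)           ≡⟨ sym (+-assoc x _ _) ⟩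
    x + 3 * (y′ + d) + 3 * z             ≡⟨ m≡ ⟩
    x′ + 3 * y′ + 3 * z′                 ≡⟨ cong (λ v → x′ + 3 * y′ + 3 * v) z′≡ ⟩
    x′ + 3 * y′ + 3 * (2 * d + z)        ≡⟨ solve (x′ ∷ y′ ∷ d ∷ z ∷ []) ⟩
    3 * d + x′ + (3 * (y′ + d) + 3 * z)  ∎)

weight-mass-injective : ∀ {x y z t′} → z ≤ 1 → (x ≤ 2 ⊎ y ≡ 0) →
  weight (x , y , z) ≡ weight t′ → mass (x , y , z) ≡ mass t′ → (x , y , z) ≡ t′
weight-mass-injective {x} {y} {z} {x′ , y′ , z′} z≤1 untradeable w≡ m≡
  with weight-mass-trade {x} {y} {z} {x′} {y′} {z′} z≤1 w≡ m≡ | untradeable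
... | zero  , refl , refl , refl | _        = refl
... | suc d , refl , _    , _    | inj₁ x≤2 = ⊥-elim (≤⇒≯ x≤2 (≤-trans (*-monoʳ-≤ 3 (s≤s z≤n)) (m≤m+n (3 * suc d) x′)))
... | suc d , _    , refl , _    | inj₂ ()

Rigid : ℕ → Triple → Set
Rigid k (x , y , z) = 2 * y + z ≤ k × 2 * x + 3 * z ≤ 3 * k × z ≤ 1 × (x ≤ 2 ⊎ y ≡ 0)

rigid⇒unique : ∀ k {t t′} → Rigid k t → eval k t′ ≡ eval k t → t′ ≡ t
rigid⇒unique k {t@(x , y , z)} {t′@(x′ , y′ , z′)} (w≤k , 2x+3z≤3k , z≤1 , untradeable) eq =
  sym (weight-mass-injective {t′ = t′} z≤1 untradeable (proj₁ same) (sym (proj₂ same)))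
  where
  open ≤-Reasoning
  w′<w+n : weight t′ < weight t + suc k
  w′<w+n = *-cancelʳ-< (1 + 3 * k) (weight t′) (weight t + suc k) (begin-strict
    weight t′ * (1 + 3 * k)                               ≤⟨ m≤m+n _ _ ⟩
    weight t′ * (1 + 3 * k) + (2 * x′ + 3 * z′) * suc k   ≡⟨ sym (2*eval≡weight*[1+3k]+[2x+3z]*[1+k] k x′ y′ z′) ⟩
    2 * eval k t′                                         ≡⟨ cong (2 *_) eq ⟩
    2 * eval k t                                          ≡⟨ 2*eval≡weight*[1+3k]+[2x+3z]*[1+k] k x y z ⟩
    weight t * (1 + 3 * k) + (2 * x + 3 * z) * suc k      <⟨ +-monoʳ-< (weight t * (1 + 3 * k)) (*-monoˡ-< (suc k) (s≤s 2x+3z≤3k)) ⟩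
    weight t * (1 + 3 * k) + (1 + 3 * k) * suc k          ≡⟨ solve (k ∷ y ∷ z ∷ []) ⟩
    (weight t + suc k) * (1 + 3 * k)                      ∎)
  same : weight t ≡ weight t′ × mass t′ ≡ mass t
  same = weight-mass-unique k t (s≤s w≤k) w′<w+n
    (trans (cong (_+ weight t′) (sym eq)) (eval+weight≡mass*[1+k] k t′))

rigid⇒UniqueFact : ∀ k {s t} → Rigid k t → IsFact (suc k) s t → UniqueFact (suc k) s
rigid⇒UniqueFact k {t = t} rigid fact = t , fact , λ {t′} fact′ →
  sym (rigid⇒unique k rigid (trans (IsFact⇒eval≡ k t′ fact′) (sym (IsFact⇒eval≡ k t fact))))

-- F(T) = (3n - 4)(n - 1)/2 for n = 5 + 2m.
frob : ℕ → ℕ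
frob m = (11 + 6 * m) * (2 + m)
{-# INLINE frob #-}

-- A factorization of F(T) with y + z ≥ (n - 1)/2 is too large; otherwise its weight is at
-- most n - 3, while F(T) + (n - 2) is a multiple of n.
eval≢frob : ∀ m t → eval (4 + 2 * m) t ≢ frob m
eval≢frob m (x , y , z) eval≡F with 2 + m ≤? y + z
... | yes 2+m≤y+z = <⇒≢ F<eval (sym eval≡F)
  where
  open ≤-Reasoning
  F<eval : frob m < eval (4 + 2 * m) (x , y , z)
  F<eval = begin-strict
    frob m                          <⟨ m<m+n (frob m) z<s ⟩
    frob m + (4 + 2 * m)            ≡⟨ solve (m ∷ []) ⟩
    (2 + m) * (1 + 3 * (4 + 2 * m)) ≤⟨ *-monoˡ-≤ _ 2+m≤y+z ⟩
    (y + z) * (1 + 3 * (4 + 2 * m)) ≤⟨ [y+z]*[1+3k]≤eval (4 + 2 * m) x y z ⟩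
    eval (4 + 2 * m) (x , y , z)    ∎
... | no 2+m≰y+z = ≤⇒≯ w≤2+2m (≤-reflexive (sym (proj₁ w≡3+2m)))
  where
  open ≤-Reasoning
  w≤2+2m : 2 * y + z ≤ 2 + 2 * m
  w≤2+2m = begin
    2 * y + z       ≤⟨ +-monoʳ-≤ (2 * y) (m≤n+m z z) ⟩
    2 * y + (z + z) ≡⟨ solve (y ∷ z ∷ []) ⟩
    2 * (y + z)     ≤⟨ *-monoʳ-≤ 2 (s≤s⁻¹ (≰⇒> 2+m≰y+z)) ⟩
    2 * (1 + m)     ≡⟨ *-suc 2 m ⟩
    2 + 2 * m       ∎
  F+[3+2m]≡[5+3m]n : frob m + (3 + 2 * m) ≡ (5 + 3 * m) * (5 + 2 * m)
  F+[3+2m]≡[5+3m]n = solve (m ∷ [])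
  w≡3+2m : 2 * y + z ≡ 3 + 2 * m × 5 + 3 * m ≡ x + 3 * y + 3 * z
  w≡3+2m = weight-mass-unique (4 + 2 * m) (x , y , z)
    (≤-<-trans w≤2+2m (m<n+m (2 + 2 * m) {3} z<s))
    (<-≤-trans (m<n+m (3 + 2 * m) {2} z<s) (m≤n+m (5 + 2 * m) (2 * y + z)))
    (trans (cong (_+ (3 + 2 * m)) eval≡F) F+[3+2m]≡[5+3m]n)

eval[d,2+m,0]≡1+eval[5+3m+d,0,0] : ∀ m d → eval (4 + 2 * m) (d , 2 + m , 0) ≡ suc (eval (4 + 2 * m) (5 + 3 * m + d , 0 , 0))
eval[d,2+m,0]≡1+eval[5+3m+d,0,0] m d = solve (m ∷ d ∷ [])

eval[d,3+m,0]≡eval[5+3m+d,0,1] : ∀ m d → eval (4 + 2 * m) (d , 3 + m , 0) ≡ eval (4 + 2 * m) (5 + 3 * m + d , 0 , 1)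
eval[d,3+m,0]≡eval[5+3m+d,0,1] m d = solve (m ∷ d ∷ [])

frob<eval[x,0,0]⇒5+3m≤x : ∀ m x → frob m < eval (4 + 2 * m) (x , 0 , 0) → 5 + 3 * m ≤ x
frob<eval[x,0,0]⇒5+3m≤x m x F<eval = *-cancelʳ-< (5 + 2 * m) (4 + 3 * m) x (begin-strict
  (4 + 3 * m) * (5 + 2 * m)     ≤⟨ m≤m+n _ 2 ⟩
  (4 + 3 * m) * (5 + 2 * m) + 2 ≡⟨ solve (m ∷ []) ⟩
  frob m                        <⟨ F<eval ⟩
  eval (4 + 2 * m) (x , 0 , 0)  ≡⟨ solve (m ∷ x ∷ []) ⟩
  x * (5 + 2 * m)               ∎)
  where open ≤-Reasoning

frob<eval⇒suc-eval : ∀ m t → frob m < eval (4 + 2 * m) t →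
  ∃[ t′ ] eval (4 + 2 * m) t′ ≡ suc (eval (4 + 2 * m) t)
frob<eval⇒suc-eval m (x , suc y , z) _ = (x , y , suc z) , eval-y→z (4 + 2 * m) x y z
frob<eval⇒suc-eval m (x , zero , suc z) _ = (3 + x , zero , z) , eval-z→x (4 + 2 * m) x zero z
frob<eval⇒suc-eval m (x , zero , zero) F<eval = (x ∸ (5 + 3 * m) , 2 + m , 0) , (begin
  eval (4 + 2 * m) (x ∸ (5 + 3 * m) , 2 + m , 0)                 ≡⟨ eval[d,2+m,0]≡1+eval[5+3m+d,0,0] m (x ∸ (5 + 3 * m)) ⟩
  suc (eval (4 + 2 * m) (5 + 3 * m + (x ∸ (5 + 3 * m)) , 0 , 0)) ≡⟨ cong (λ v → suc (eval (4 + 2 * m) (v , 0 , 0)))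
                                                                        (m+[n∸m]≡n (frob<eval[x,0,0]⇒5+3m≤x m x F<eval)) ⟩
  suc (eval (4 + 2 * m) (x , 0 , 0))                             ∎)
  where open ≡-Reasoning

frob+suc-eval : ∀ m j → ∃[ t ] eval (4 + 2 * m) t ≡ frob m + suc j
frob+suc-eval m zero = (2 , 1 + m , 0) , solve (m ∷ [])
frob+suc-eval m (suc j) with frob+suc-eval m j
... | t , eval≡ with frob<eval⇒suc-eval m t (subst (frob m <_) (sym eval≡) (m<m+n (frob m) z<s))
...   | t′ , eval′≡ = t′ , trans eval′≡ (trans (cong suc eval≡) (sym (+-suc (frob m) (suc j))))

frob∉T : ∀ m → ¬ InT (5 + 2 * m) (frob m)
frob∉T m (t , fact) = eval≢frob m t (IsFact⇒eval≡ (4 + 2 * m) t fact)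

frob+suc∈T : ∀ m j → InT (5 + 2 * m) (frob m + suc j)
frob+suc∈T m j = let (t , eval≡) = frob+suc-eval m j in t , eval≡⇒IsFact (4 + 2 * m) t eval≡

IsFrobT⇒≡frob : ∀ m {f} → IsFrobT (5 + 2 * m) f → f ≡ frob m
IsFrobT⇒≡frob m {f} (f∉T , >f⇒∈T) with <-cmp f (frob m)
... | tri< f<F _ _ = ⊥-elim (frob∉T m (>f⇒∈T (frob m) f<F))
... | tri≈ _ f≡F _ = f≡F
... | tri> _ _ F<f with m≤n⇒∃[o]m+o≡n {suc (frob m)} {f} F<f
...   | j , refl = ⊥-elim (f∉T (subst (InT (5 + 2 * m)) (+-suc (frob m) j) (frob+suc∈T m j)))

InAp⇒≢frob+eval : ∀ m {s} → InAp (5 + 2 * m) (frob m) s → ∀ t → s ≢ frob m + eval (4 + 2 * m) t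
InAp⇒≢frob+eval m (_ , s∸F∉S) t refl =
  s∸F∉S (m≤m+n (frob m) _) (inj₁ (t , eval≡⇒IsFact (4 + 2 * m) t (sym (m+n∸m≡n (frob m) _))))

n+1≡2[3+m] : ∀ m → 5 + 2 * m + 1 ≡ 2 * (3 + m)
n+1≡2[3+m] = solve-∀

1+2[7+3m]≡3n : ∀ m → 1 + 2 * (7 + 3 * m) ≡ 3 * (5 + 2 * m)
1+2[7+3m]≡3n = solve-∀

3+2[6+3m]≡3n : ∀ m → 3 + 2 * (6 + 3 * m) ≡ 3 * (5 + 2 * m)
3+2[6+3m]≡3n = solve-∀

7+2[4+3m]≡3n : ∀ m → 7 + 2 * (4 + 3 * m) ≡ 3 * (5 + 2 * m)
7+2[4+3m]≡3n = solve-∀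

IsNF⇒bounds : ∀ m {s x y z} → IsNF (5 + 2 * m) s (x , y , z) → z ≤ 1 × y ≤ 2 + m × x ≤ 6 + 3 * m
IsNF⇒bounds m {x = x} {y} (_ , z<2 , 2y<n+1 , 2x<3n∸1) =
  s≤s⁻¹ z<2 ,
  s≤s⁻¹ (*-cancelˡ-< 2 y (3 + m) (subst (2 * y <_) (n+1≡2[3+m] m) 2y<n+1)) ,
  s≤s⁻¹ (*-cancelˡ-< 2 x (7 + 3 * m) (subst (2 * x <_) (sym (cong (_∸ 1) (1+2[7+3m]≡3n m))) 2x<3n∸1))

≤12⇒≤3[4+2m] : ∀ m {u} → u ≤ 12 → u ≤ 3 * (4 + 2 * m)
≤12⇒≤3[4+2m] m u≤12 = ≤-trans u≤12 (*-monoʳ-≤ 3 (m≤m+n 4 (2 * m)))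

Cond⇒Rigid : ∀ m {x y z} → Cond (5 + 2 * m) (x , y , z) → Rigid (4 + 2 * m) (x , y , z)
Cond⇒Rigid m {x} (inj₁ (refl , refl , 2x≤)) =
  z≤n , ≤-trans (≤-reflexive (+-identityʳ (2 * x))) (≤-trans 2x≤ (≤-reflexive (cong (_∸ 3) (*-suc 3 (4 + 2 * m))))) ,
  z≤n , inj₂ refl
Cond⇒Rigid m {x} (inj₂ (inj₁ (refl , refl , 2x≤))) = s≤s z≤n , 2x+3≤3k , s≤s z≤n , inj₂ refl
  where
  open ≤-Reasoning
  2x+3≤3k : 2 * x + 3 ≤ 3 * (4 + 2 * m)
  2x+3≤3k = begin
    2 * x + 3                    ≤⟨ +-monoˡ-≤ 3 2x≤ ⟩
    3 * (5 + 2 * m) ∸ 7 + 3      ≡⟨ cong (λ v → v ∸ 7 + 3) (sym (7+2[4+3m]≡3n m)) ⟩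
    2 * (4 + 3 * m) + 3          ≤⟨ m≤n+m _ 1 ⟩
    1 + (2 * (4 + 3 * m) + 3)    ≡⟨ solve (m ∷ []) ⟩
    3 * (4 + 2 * m)              ∎
Cond⇒Rigid m {y = y} (inj₂ (inj₂ (inj₁ (refl , refl , _ , 2y≤)))) =
  ≤-trans (≤-reflexive (+-identityʳ (2 * y))) (≤-trans 2y≤ (m≤n+m _ 2)) ,
  ≤12⇒≤3[4+2m] m (m≤m+n 4 8) , z≤n , inj₁ ≤-refl
Cond⇒Rigid m {x} {y} (inj₂ (inj₂ (inj₂ (inj₁ (refl , x≤1 , _ , 2y≤))))) =
  ≤-trans (≤-reflexive (+-identityʳ (2 * y))) 2y≤ ,
  ≤12⇒≤3[4+2m] m (≤-trans (+-monoˡ-≤ 0 (*-monoʳ-≤ 2 x≤1)) (m≤m+n 2 10)) , z≤n , inj₁ (m≤n⇒m≤1+n x≤1)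
Cond⇒Rigid m {x} {y} (inj₂ (inj₂ (inj₂ (inj₂ (refl , x≤2 , _ , 2y≤))))) =
  ≤-trans (+-monoˡ-≤ 1 2y≤) (≤-trans (≤-reflexive (+-comm (2 * m) 1)) (m≤n+m _ 3)) ,
  ≤12⇒≤3[4+2m] m (≤-trans (+-monoˡ-≤ 3 (*-monoʳ-≤ 2 x≤2)) (m≤m+n 7 5)) , s≤s z≤n , inj₁ x≤2

data NFCase (m : ℕ) (t : Triple) : Set where
  satisfies : Cond (5 + 2 * m) t → NFCase m t
  ambiguous : ∀ t′ → t′ ≢ t → eval (4 + 2 * m) t′ ≡ eval (4 + 2 * m) t → NFCase m t
  frob-plus : ∀ t′ → eval (4 + 2 * m) t ≡ frob m + eval (4 + 2 * m) t′ → NFCase m t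

2*-mono-≤ : ∀ {u v w} → u ≤ v → 2 * v ≡ w → 2 * u ≤ w
2*-mono-≤ u≤v refl = *-monoʳ-≤ 2 u≤v

classify-tradeless : ∀ m {x y z} → x ≤ 2 → z ≤ 1 → suc y ≤ 2 + m → NFCase m (x , suc y , z)
classify-tradeless m {x} {y} {zero} x≤2 _ y< with m≤n⇒m<n∨m≡n x≤2
... | inj₁ x<2 = satisfies (inj₂ (inj₂ (inj₂ (inj₁ (refl , s≤s⁻¹ x<2 , s≤s z≤n ,
  2*-mono-≤ y< (trans (*-suc 2 (1 + m)) (cong (2 +_) (*-suc 2 m))))))))
... | inj₂ refl with m≤n⇒m<n∨m≡n y<
...   | inj₁ y<2+m = satisfies (inj₂ (inj₂ (inj₁ (refl , refl , s≤s z≤n , 2*-mono-≤ (s≤s⁻¹ y<2+m) (*-suc 2 m)))))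
...   | inj₂ refl  = frob-plus (0 , 0 , 1) (solve (m ∷ []))
classify-tradeless m {x} {y} {suc zero} x≤2 _ y< with m≤n⇒m<n∨m≡n y<
... | inj₂ refl = ambiguous (8 + 3 * m + x , 0 , 0) (λ ()) (solve (m ∷ x ∷ []))
... | inj₁ y<2+m with m≤n⇒m<n∨m≡n (s≤s⁻¹ y<2+m)
...   | inj₂ refl  = frob-plus (suc x , 0 , 0) (solve (m ∷ x ∷ []))
...   | inj₁ y<1+m = satisfies (inj₂ (inj₂ (inj₂ (inj₂ (refl , x≤2 , s≤s z≤n , *-monoʳ-≤ 2 (s≤s⁻¹ y<1+m))))))
classify-tradeless m {z = suc (suc _)} _ (s≤s ()) _

classify : ∀ m {x y z} → z ≤ 1 × y ≤ 2 + m × x ≤ 6 + 3 * m → NFCase m (x , y , z)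
classify m {x} {zero} {zero} (_ , _ , x≤) =
  satisfies (inj₁ (refl , refl , 2*-mono-≤ x≤ (cong (_∸ 3) (3+2[6+3m]≡3n m))))
classify m {x} {zero} {suc zero} _ with x ≤? 4 + 3 * m
... | yes x≤ = satisfies (inj₂ (inj₁ (refl , refl , 2*-mono-≤ x≤ (cong (_∸ 7) (7+2[4+3m]≡3n m)))))
... | no x≰ = ambiguous (x ∸ (5 + 3 * m) , 3 + m , 0) (λ ()) (begin
  eval (4 + 2 * m) (x ∸ (5 + 3 * m) , 3 + m , 0)             ≡⟨ eval[d,3+m,0]≡eval[5+3m+d,0,1] m (x ∸ (5 + 3 * m)) ⟩
  eval (4 + 2 * m) (5 + 3 * m + (x ∸ (5 + 3 * m)) , 0 , 1)   ≡⟨ cong (λ v → eval (4 + 2 * m) (v , 0 , 1)) (m+[n∸m]≡n (≰⇒> x≰)) ⟩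
  eval (4 + 2 * m) (x , 0 , 1)                               ∎)
  where open ≡-Reasoning
classify m {y = zero} {suc (suc _)} (s≤s () , _)
classify m {x} {suc y} {z} (z≤1 , y< , _) with x ≤? 2
... | yes x≤2 = classify-tradeless m x≤2 z≤1 y<
... | no x≰2 = ambiguous (x ∸ 3 , y , 2 + z) (λ ()) (begin
  eval (4 + 2 * m) (x ∸ 3 , y , 2 + z)               ≡⟨ sym (eval-trade (4 + 2 * m) (x ∸ 3) y z) ⟩
  eval (4 + 2 * m) (3 + (x ∸ 3) , suc y , z)         ≡⟨ cong (λ v → eval (4 + 2 * m) (v , suc y , z)) (m+[n∸m]≡n (≰⇒> x≰2)) ⟩
  eval (4 + 2 * m) (x , suc y , z)                   ∎)
  where open ≡-Reasoning

UniqueFact⇒Cond : ∀ m {s x y z} → InAp (5 + 2 * m) (frob m) s → IsNF (5 + 2 * m) s (x , y , z) →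
  UniqueFact (5 + 2 * m) s → Cond (5 + 2 * m) (x , y , z)
UniqueFact⇒Cond m {s} {x} {y} {z} s∈Ap nf@(fact , _) (_ , _ , unique) with classify m (IsNF⇒bounds m nf)
... | satisfies c = c
... | ambiguous t′ t′≢t eq = ⊥-elim (t′≢t (trans (sym (unique fact′)) (unique fact)))
  where
  fact′ : IsFact (5 + 2 * m) s t′
  fact′ = eval≡⇒IsFact (4 + 2 * m) t′ (trans eq (IsFact⇒eval≡ (4 + 2 * m) (x , y , z) fact))
... | frob-plus t′ eq = ⊥-elim (InAp⇒≢frob+eval m s∈Ap t′ (trans (sym (IsFact⇒eval≡ (4 + 2 * m) (x , y , z) fact)) eq))

mainTheorem5 : (n : ℕ) → 5 ≤ n → ¬ (2 ∣ n) →
    (f : ℕ) → IsFrobT n f →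
    (s : ℕ) → InAp n f s →
    (t : Triple) → IsNF n s t →
    (UniqueFact n s ⇔ Cond n t)
mainTheorem5 n 5≤n 2∤n f f-frob s s∈Ap (_ , _ , _) t-nf with odd≥5⇒≡5+2* 5≤n 2∤n
... | m , refl with IsFrobT⇒≡frob m f-frob
...   | refl = mk⇔ (UniqueFact⇒Cond m s∈Ap t-nf)
                   (λ c → rigid⇒UniqueFact (4 + 2 * m) (Cond⇒Rigid m c) (proj₁ t-nf))
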